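{- Let $n\ge 2$ be an integer. Suppose that for all integers $m,k$ with $2\le m\le n$ and $2\le k\le 2^{m-1}+1$, $$v_2(s(2^n,2^m-k)) = 2^n-2^m-(n-m)\Big(2^m-2\Big\lfloor\frac{k}{2}\Big\rfloor\Big) + m-2-v_2\Big(\Big\lfloor\frac{k}{2}\Big\rfloor\Big)+(n-1)\epsilon_k,$$ where $\epsilon_k=0$ if $k$ is even and $\epsilon_k=1$ if $k$ is odd. Then for any integer $t$ with $1\le t\le 2^n$, we have $v_2(s_{2^n}(2^n,t))=v_2(s(2^n,t))$ and $v_2(s_{2^n}(2^n,t)-s(2^n,t))\ge v_2(s(2^n,t))+2$.
   Context: For nonnegative integers $n,k$, $s(n,k)$ is defined by $x(x+1)\cdots(x+n-1)=\sum_{k=0}^{n}s(n,k)x^k$, with $s(n,k)=0$ for $k>n$. For a nonnegative integer $m$, $s_m(n,k)$ is defined by $(x+m)(x+m+1)\cdots(x+m+n-1)=\sum_{k=0}^{n}s_m(n,k)x^k$. $v_2$ is the 2-adic valuation, with the convention $v_2(0)=+\infty$. -}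

module Defs where

open import Data.Nat using (ℕ; zero; suc; _+_; _*_; _≤_)
open import Data.Nat.DivMod using (_/_; _%_)
open import Data.Integer using (ℤ; +_)
import Data.Integer as ℤ
open import Data.Empty using (⊥)
open import Data.Unit using (⊤)

-- s_m(n,k): coefficient of x^k in (x+m)(x+m+1)...(x+m+n-1),
-- computed via (x+m)...(x+m+n) = [(x+m)...(x+m+n-1)] * (x+(m+n)).
-- Automatically 0 for k > n.
sm : ℕ → ℕ → ℕ → ℕ
sm m zero zero = 1
sm m zero (suc k) = 0
sm m (suc n) zero = (m + n) * sm m n zero
sm m (suc n) (suc k) = sm m n k + (m + n) * sm m n (suc k)

s : ℕ → ℕ → ℕ
s n k = sm 0 n k

-- 2-adic valuation of a natural number, with fuel (fuel = n suffices for n ≥ 1).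
v2-aux : ℕ → ℕ → ℕ
v2-aux zero n = 0
v2-aux (suc fuel) zero = 0
v2-aux (suc fuel) (suc n) with (suc n) % 2
... | zero = suc (v2-aux fuel (suc n / 2))
... | suc _ = 0

-- v2 on positive naturals (value at 0 is meaningless; only used on nonzero arguments)
v2ℕ : ℕ → ℕ
v2ℕ n = v2-aux n n

data ℕ∞ : Set where
  fin : ℕ → ℕ∞
  ∞   : ℕ∞

infix 4 _≤∞_
infixl 6 _+∞_

_≤∞_ : ℕ∞ → ℕ∞ → Set
fin a ≤∞ fin b = a ≤ b
fin a ≤∞ ∞ = ⊤
∞ ≤∞ fin b = ⊥
∞ ≤∞ ∞ = ⊤

_+∞_ : ℕ∞ → ℕ → ℕ∞
fin a +∞ b = fin (a + b)
∞ +∞ b = ∞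

ν2 : ℤ → ℕ∞
ν2 x with ℤ.∣ x ∣
... | zero = ∞
... | suc a = fin (v2ℕ (suc a))

eps : ℕ → ℕ
eps k = k % 2

rhs : ℕ → ℕ → ℕ → ℤ
rhs n m k =
  ((((+ (2 Data.Nat.^ n) ℤ.- + (2 Data.Nat.^ m))
     ℤ.- (+ n ℤ.- + m) ℤ.* (+ (2 Data.Nat.^ m) ℤ.- + (2 * (k / 2))))
     ℤ.+ + m ℤ.- + 2) ℤ.- + v2ℕ (k / 2))
     ℤ.+ (+ n ℤ.- + 1) ℤ.* + eps k

module Submission where

-- Put N = 2^n and V t = v2(s(N,t)). Taylor's formula for P(x) = x(x+1)⋯(x+N-1) at x + N gives
--   s_N(N,t) = Σ_{j ≥ t} C(j,t) N^(j-t) s(N,j) = s(N,t) + Σ_{j > t} C(j,t) N^(j-t) s(N,j),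
-- so it suffices that 2^(V t + 2) divides every summand j > t ('perturbation' then gives both claims).
-- That follows from a local estimate on consecutive values ('Step'):  V t + 1 ≤ V (t+1) + n, and even
-- V t + 2 ≤ V (t+1) + n unless t + 1 is even. Summing the first inequality handles j ≥ t + 2, since the
-- summand carries 2^(n(j-t)) · 2^(V j); for j = t + 1 the second one, or the factor C(t+1,t) = t + 1, does.
-- The local estimate comes from the hypothesis: every 1 ≤ t ≤ N - 2 is 2^m - k in a 'Window', and comparing
-- the formula at t and t + 1 is integer arithmetic split by the shape of k (odd, 2, or even ≥ 4); the
-- remaining t = N - 1 is handled by s(N, N-1) = 2^(n-1)(N - 1).

open import Defs
open import Data.Nat
open import Data.Nat.Properties
open import Data.Nat.DivMod using (_/_; _%_; m≡m%n+[m/n]*n; m/n<m; m*n/n≡m; m*n%n≡0; [m+kn]%n≡m%n; +-distrib-/-∣ʳ)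
open import Data.Nat.Divisibility
open import Data.Nat.Combinatorics using (_C_; nCk+nC[k+1]≡[n+1]C[k+1]; k>n⇒nCk≡0; nCn≡1; nC1≡n; nCk≡nC[n∸k])
open import Data.Integer using (ℤ; +_)
import Data.Integer as ℤ
import Data.Integer.Properties as ℤP
open import Data.Integer.Tactic.RingSolver using () renaming (solve-∀ to ℤ-solve)
open import Data.Unit using (tt)
open import Data.Product using (Σ; _×_; _,_; proj₁)
open import Data.Sum using (_⊎_; inj₁; inj₂)
open import Data.Empty using (⊥-elim)
open import Relation.Nullary using (¬_; yes; no)
open import Function using (case_of_)
open import Data.Nat.Tactic.RingSolver using () renaming (solve-∀ to ℕ-solve)
open import Relation.Binary.PropositionalEquality

record Exact (v x : ℕ) : Set where
  constructor exact
  field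
    pow∣ : 2 ^ v ∣ x
    pow∤ : ¬ 2 ^ suc v ∣ x
open Exact

2^-mono-∣ : ∀ {a b} → a ≤ b → 2 ^ a ∣ 2 ^ b
2^-mono-∣ {a} {b} a≤b = divides (2 ^ (b ∸ a)) (begin
  2 ^ b             ≡⟨ cong (2 ^_) (sym (m+[n∸m]≡n a≤b)) ⟩
  2 ^ (a + (b ∸ a)) ≡⟨ ^-distribˡ-+-* 2 a (b ∸ a) ⟩
  2 ^ a * 2 ^ (b ∸ a) ≡⟨ *-comm (2 ^ a) _ ⟩
  2 ^ (b ∸ a) * 2 ^ a ∎)
  where open ≡-Reasoning

exact-≤ : ∀ {v c x} → Exact v x → 2 ^ c ∣ x → c ≤ v
exact-≤ {v} {c} (exact _ ¬2^1+v∣x) 2^c∣x with ≤-<-connex c v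
... | inj₁ c≤v = c≤v
... | inj₂ v<c = ⊥-elim (¬2^1+v∣x (∣-trans (2^-mono-∣ v<c) 2^c∣x))

exact-unique : ∀ {a b x} → Exact a x → Exact b x → a ≡ b
exact-unique ea eb = ≤-antisym (exact-≤ eb (pow∣ ea)) (exact-≤ ea (pow∣ eb))

exact-nonzero : ∀ {v x} → Exact v x → 1 ≤ x
exact-nonzero {x = zero} (exact _ ¬2^1+v∣0) = ⊥-elim (¬2^1+v∣0 (_ ∣0))
exact-nonzero {x = suc _} _ = s≤s z≤n

exact-double : ∀ {v x} → Exact v x → Exact (suc v) (2 * x)
exact-double (exact 2^v∣x ¬2^1+v∣x) = exact (*-monoʳ-∣ 2 2^v∣x) λ d → ¬2^1+v∣x (*-cancelˡ-∣ 2 d)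

exact-odd : ∀ {x} → ¬ 2 ∣ x → Exact 0 x
exact-odd ¬2∣x = exact (1∣ _) ¬2∣x

exact-+ : ∀ {v x e} → Exact v x → 2 ^ suc v ∣ e → Exact v (x + e)
exact-+ {v} {x} {e} (exact 2^v∣x ¬2^1+v∣x) 2^1+v∣e =
  exact (∣m∣n⇒∣m+n 2^v∣x (∣-trans (2^-mono-∣ (n≤1+n v)) 2^1+v∣e))
  λ d → ¬2^1+v∣x (∣m+n∣m⇒∣n (subst (2 ^ suc v ∣_) (+-comm x e) d) 2^1+v∣e)

v2-aux-exact : ∀ fuel x → 1 ≤ x → x ≤ fuel → Exact (v2-aux fuel x) x
v2-aux-exact (suc f) (suc x) _ x≤f with suc x % 2 in r
... | suc _ = exact-odd λ 2∣x → 0≢1+n (trans (sym (n∣m⇒m%n≡0 _ 2 2∣x)) r)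
... | zero  = subst (Exact (suc (v2-aux f h))) (sym x≡2h) (exact-double (v2-aux-exact f h 1≤h h≤f))
  where
  h = suc x / 2
  x≡2h : suc x ≡ 2 * h
  x≡2h = trans (m≡m%n+[m/n]*n (suc x) 2) (trans (cong (_+ h * 2) r) (*-comm h 2))
  1≤h : 1 ≤ h
  1≤h with h | x≡2h
  ... | zero  | ()
  ... | suc _ | _ = s≤s z≤n
  h≤f : h ≤ f
  h≤f = ≤-pred (<-≤-trans (m/n<m (suc x) 2 ≤-refl) x≤f)

v2ℕ-exact : ∀ {x} → 1 ≤ x → Exact (v2ℕ x) x
v2ℕ-exact {x} 1≤x = v2-aux-exact x x 1≤x ≤-refl

exact-pow : ∀ m → Exact m (2 ^ m)
exact-pow zero    = exact-odd λ 2∣1 → case ∣1⇒≡1 2∣1 of λ ()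
exact-pow (suc m) = exact-double (exact-pow m)

-- Needed to evaluate the hypothesis at k = 2^m + 1, where ⌊k/2⌋ = 2^(m-1).
v2ℕ-pow : ∀ m → v2ℕ (2 ^ m) ≡ m
v2ℕ-pow m = exact-unique (v2ℕ-exact (m^n>0 2 m)) (exact-pow m)

v2ℕ-of-exact : ∀ {v x} → Exact v x → v2ℕ x ≡ v
v2ℕ-of-exact ex = exact-unique (v2ℕ-exact (exact-nonzero ex)) ex

ν2-exact : ∀ {v x} → Exact v x → ν2 (+ x) ≡ fin v
ν2-exact {x = zero}  e = ⊥-elim (<⇒≱ (exact-nonzero e) z≤n)
ν2-exact {x = suc _} e = cong fin (v2ℕ-of-exact e)

ν2-fin : ∀ {v x} → ν2 (+ x) ≡ fin v → v2ℕ x ≡ v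
ν2-fin {x = suc _} refl = refl

exact-< : ∀ {w p c} → Exact w p → 1 ≤ p → p < 2 ^ c → w < c
exact-< {w} {p} {c} ex 1≤p p<2^c with <-≤-connex w c
... | inj₁ w<c = w<c
... | inj₂ c≤w = ⊥-elim (<⇒≱ p<2^c (≤-trans (^-monoʳ-≤ 2 c≤w) (∣⇒≤ ⦃ >-nonZero 1≤p ⦄ (pow∣ ex))))

ν2-≥ : ∀ {c E} → 2 ^ c ∣ E → fin c ≤∞ ν2 (+ E)
ν2-≥ {E = zero}  _     = tt
ν2-≥ {E = suc _} 2^c∣E = exact-≤ (v2ℕ-exact (s≤s z≤n)) 2^c∣E

perturbation : ∀ {v x E} → Exact v x → 2 ^ (v + 2) ∣ E →
  (ν2 (+ (x + E)) ≡ ν2 (+ x)) × (ν2 (+ x) +∞ 2 ≤∞ ν2 (+ (x + E) ℤ.- + x))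
perturbation {v} {x} {E} ex 2^[v+2]∣E = same-valuation , difference-valuation
  where
  same-valuation : ν2 (+ (x + E)) ≡ ν2 (+ x)
  same-valuation = trans (ν2-exact (exact-+ ex 2^[v+1]∣E)) (sym (ν2-exact ex))
    where
    2^[v+1]∣E : 2 ^ suc v ∣ E
    2^[v+1]∣E = ∣-trans (2^-mono-∣ (≤-trans (n≤1+n (suc v)) (≤-reflexive (+-comm 2 v)))) 2^[v+2]∣E
  difference : + (x + E) ℤ.- + x ≡ + E
  difference = trans (cong (ℤ._- + x) (ℤP.pos-+ x E)) (cancel (+ x) (+ E))
    where
    cancel : ∀ a b → a ℤ.+ b ℤ.- a ≡ b
    cancel = ℤ-solve
  difference-valuation : ν2 (+ x) +∞ 2 ≤∞ ν2 (+ (x + E) ℤ.- + x)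
  difference-valuation rewrite ν2-exact ex | difference = ν2-≥ 2^[v+2]∣E

sum< : ℕ → (ℕ → ℕ) → ℕ
sum< zero    f = 0
sum< (suc L) f = f 0 + sum< L (λ i → f (suc i))

sum<-cong : ∀ L {f g} → (∀ i → f i ≡ g i) → sum< L f ≡ sum< L g
sum<-cong zero    f≗g = refl
sum<-cong (suc L) f≗g = cong₂ _+_ (f≗g 0) (sum<-cong L (λ i → f≗g (suc i)))

sum<-zero : ∀ L {f} → (∀ i → f i ≡ 0) → sum< L f ≡ 0
sum<-zero zero    f≗0 = refl
sum<-zero (suc L) f≗0 = cong₂ _+_ (f≗0 0) (sum<-zero L (λ i → f≗0 (suc i)))

sum<-+ : ∀ L f g → sum< L (λ i → f i + g i) ≡ sum< L f + sum< L g
sum<-+ zero    f g = refl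
sum<-+ (suc L) f g = begin
  f 0 + g 0 + sum< L (λ i → f (suc i) + g (suc i))
    ≡⟨ cong (λ z → f 0 + g 0 + z) (sum<-+ L (λ i → f (suc i)) (λ i → g (suc i))) ⟩
  f 0 + g 0 + (sum< L (λ i → f (suc i)) + sum< L (λ i → g (suc i)))
    ≡⟨ +-assoc-swap (f 0) (g 0) _ _ ⟩
  f 0 + sum< L (λ i → f (suc i)) + (g 0 + sum< L (λ i → g (suc i))) ∎
  where
  open ≡-Reasoning
  +-assoc-swap : ∀ a b c d → a + b + (c + d) ≡ a + c + (b + d)
  +-assoc-swap = ℕ-solve

sum<-* : ∀ L c f → sum< L (λ i → c * f i) ≡ c * sum< L f
sum<-* zero    c f = sym (*-zeroʳ c)
sum<-* (suc L) c f = trans (cong (λ z → c * f 0 + z) (sum<-* L c (λ i → f (suc i))))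
                           (sym (*-distribˡ-+ c (f 0) _))

sum<-∣ : ∀ L d f → (∀ j → j < L → d ∣ f j) → d ∣ sum< L f
sum<-∣ zero    d f d∣f = d ∣0
sum<-∣ (suc L) d f d∣f =
  ∣m∣n⇒∣m+n (d∣f 0 z<s) (sum<-∣ L d (λ i → f (suc i)) (λ j j<L → d∣f (suc j) (s<s j<L)))

sum<-split : ∀ L t f d → t < L → (∀ j → j < t → f j ≡ 0) → (∀ j → t < j → j < L → d ∣ f j) →
             Σ ℕ λ E → sum< L f ≡ f t + E × d ∣ E
sum<-split (suc L) zero f d _ _ d∣later =
  sum< L (λ i → f (suc i)) , refl ,
  sum<-∣ L d (λ i → f (suc i)) (λ j j<L → d∣later (suc j) z<s (s<s j<L))
sum<-split (suc L) (suc t) f d (s<s t<L) earlier≡0 d∣later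
  with sum<-split L t (λ i → f (suc i)) d t<L (λ j j<t → earlier≡0 (suc j) (s<s j<t))
                  (λ j t<j j<L → d∣later (suc j) (s<s t<j) (s<s j<L))
... | E , sum≡ , d∣E = E , cong₂ _+_ (earlier≡0 0 z<s) sum≡ , d∣E

sum<-rec : ∀ L a b (f g h : ℕ → ℕ) → (∀ i → f (suc i) ≡ g i + (a * h i + b * h (suc i))) →
           sum< L (λ i → f (suc i)) ≡ sum< L g + (a * sum< L h + b * sum< L (λ i → h (suc i)))
sum<-rec L a b f g h rec = begin
  sum< L (λ i → f (suc i))
    ≡⟨ sum<-cong L rec ⟩
  sum< L (λ i → g i + (a * h i + b * h (suc i)))
    ≡⟨ sum<-+ L g _ ⟩
  sum< L g + sum< L (λ i → a * h i + b * h (suc i))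
    ≡⟨ cong (λ z → sum< L g + z) (sum<-+ L _ _) ⟩
  sum< L g + (sum< L (λ i → a * h i) + sum< L (λ i → b * h (suc i)))
    ≡⟨ cong (λ z → sum< L g + z) (cong₂ _+_ (sum<-* L a h) (sum<-* L b (λ i → h (suc i)))) ⟩
  sum< L g + (a * sum< L h + b * sum< L (λ i → h (suc i))) ∎
  where open ≡-Reasoning

-- Writing (x+m)(x+m+1)⋯(x+m+n-1) = P(x+m) with P(x) = Σ_j s(n,j) x^j, the coefficient of x^k
-- is Σ_j C(j,k) m^(j-k) s(n,j); taylor m n k j is the j-th summand.
taylor : ℕ → ℕ → ℕ → ℕ → ℕ
taylor m n k j = (j C k) * m ^ (j ∸ k) * s n j

-- C(i,k+1) m^(i-k) = m · C(i,k+1) m^(i-k-1); both sides vanish when i ≤ k.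
binom-pow : ∀ m i k → (i C suc k) * m ^ (i ∸ k) ≡ m * ((i C suc k) * m ^ (i ∸ suc k))
binom-pow m i k with <-≤-connex k i
... | inj₁ k<i = trans (cong (λ e → (i C suc k) * m ^ e) (+-∸-assoc 1 k<i))
                       (*-left-comm (i C suc k) m _)
  where
  *-left-comm : ∀ a b c → a * (b * c) ≡ b * (a * c)
  *-left-comm = ℕ-solve
... | inj₂ i≤k rewrite k>n⇒nCk≡0 (s≤s i≤k) = sym (*-zeroʳ m)

-- The summands obey the recurrence sm m (n+1) (k+1) = sm m n k + (m + n) · sm m n (k+1), shifted by one index.
taylor-rec : ∀ m n k i →
  taylor m (suc n) (suc k) (suc i) ≡ taylor m n k i + (m * taylor m n (suc k) i + n * taylor m n (suc k) (suc i))
taylor-rec m n k i = begin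
  (suc i C suc k) * p * (x + n * y)
    ≡⟨ cong (λ c → c * p * (x + n * y)) (sym pascal) ⟩
  (a + b) * p * (x + n * y)
    ≡⟨ expand a b p x y n ⟩
  a * p * x + (b * p * x + n * ((a + b) * p * y))
    ≡⟨ cong₂ (λ u c → a * p * x + (u + n * (c * p * y))) shift-power pascal ⟩
  a * p * x + (m * (b * m ^ (i ∸ suc k) * x) + n * ((suc i C suc k) * p * y)) ∎
  where
  open ≡-Reasoning
  a = i C k
  b = i C suc k
  p = m ^ (i ∸ k)
  x = s n i
  y = s n (suc i)
  pascal : a + b ≡ suc i C suc k
  pascal = nCk+nC[k+1]≡[n+1]C[k+1] i k
  expand : ∀ a b p x y n → (a + b) * p * (x + n * y) ≡ a * p * x + (b * p * x + n * ((a + b) * p * y))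
  expand = ℕ-solve
  shift-power : b * p * x ≡ m * (b * m ^ (i ∸ suc k) * x)
  shift-power = trans (cong (_* x) (binom-pow m i k)) (*-assoc m _ x)

taylor-rec₀ : ∀ m n i → taylor m (suc n) 0 (suc i) ≡ 0 + (m * taylor m n 0 i + n * taylor m n 0 (suc i))
taylor-rec₀ m n i = expand m (m ^ i) (s n i) (s n (suc i)) n
  where
  expand : ∀ m p x y n → 1 * (m * p) * (x + n * y) ≡ m * (1 * p * x) + n * (1 * (m * p) * y)
  expand = ℕ-solve

taylor-shift : ∀ m n k L → n < L → sm m n k ≡ sum< L (taylor m n k)
taylor-shift m zero k (suc L) _ = sym (begin
  taylor m 0 k 0 + sum< L (λ i → taylor m 0 k (suc i))
    ≡⟨ cong (λ z → taylor m 0 k 0 + z) (sum<-zero L (λ i → *-zeroʳ ((suc i C k) * m ^ (suc i ∸ k)))) ⟩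
  taylor m 0 k 0 + 0
    ≡⟨ +-identityʳ _ ⟩
  taylor m 0 k 0
    ≡⟨ constant-term k ⟩
  sm m 0 k ∎)
  where
  open ≡-Reasoning
  constant-term : ∀ k → taylor m 0 k 0 ≡ sm m 0 k
  constant-term zero    = refl
  constant-term (suc k) = refl
taylor-shift m (suc n) zero (suc L) (s<s n<L) = begin
  (m + n) * sm m n 0
    ≡⟨ *-distribʳ-+ (sm m n 0) m n ⟩
  m * sm m n 0 + n * sm m n 0
    ≡⟨ cong₂ (λ u v → m * u + n * v) (taylor-shift m n 0 L n<L) (taylor-shift m n 0 (suc L) (m<n⇒m<1+n n<L)) ⟩
  m * sum< L h + n * (h 0 + sum< L (λ i → h (suc i)))
    ≡⟨ rearrange m n (s n 0) (sum< L h) (sum< L (λ i → h (suc i))) ⟩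
  taylor m (suc n) 0 0 + (m * sum< L h + n * sum< L (λ i → h (suc i)))
    ≡⟨ cong (λ z → taylor m (suc n) 0 0 + (z + (m * sum< L h + n * sum< L (λ i → h (suc i)))))
            (sym (sum<-zero L {λ _ → 0} (λ _ → refl))) ⟩
  taylor m (suc n) 0 0 + (sum< L (λ _ → 0) + (m * sum< L h + n * sum< L (λ i → h (suc i))))
    ≡⟨ cong (λ z → taylor m (suc n) 0 0 + z) (sym (sum<-rec L m n (taylor m (suc n) 0) (λ _ → 0) h (taylor-rec₀ m n))) ⟩
  sum< (suc L) (taylor m (suc n) 0) ∎
  where
  open ≡-Reasoning
  h = taylor m n 0
  rearrange : ∀ m n x A B → m * A + n * (1 * 1 * x + B) ≡ 1 * 1 * (n * x) + (m * A + n * B)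
  rearrange = ℕ-solve
taylor-shift m (suc n) (suc k) (suc L) (s<s n<L) = begin
  sm m n k + (m + n) * sm m n (suc k)
    ≡⟨ cong (λ z → sm m n k + z) (*-distribʳ-+ (sm m n (suc k)) m n) ⟩
  sm m n k + (m * sm m n (suc k) + n * sm m n (suc k))
    ≡⟨ cong₂ (λ u v → u + (m * v + n * sm m n (suc k))) (taylor-shift m n k L n<L) (taylor-shift m n (suc k) L n<L) ⟩
  sum< L (taylor m n k) + (m * sum< L (taylor m n (suc k)) + n * sm m n (suc k))
    ≡⟨ cong (λ z → sum< L (taylor m n k) + (m * sum< L (taylor m n (suc k)) + n * z))
            (taylor-shift m n (suc k) (suc L) (m<n⇒m<1+n n<L)) ⟩
  sum< L (taylor m n k) + (m * sum< L (taylor m n (suc k)) + n * sum< (suc L) (taylor m n (suc k)))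
    ≡⟨ sym (sum<-rec L m n (taylor m (suc n) (suc k)) (taylor m n k) (taylor m n (suc k)) (taylor-rec m n k)) ⟩
  sum< (suc L) (taylor m (suc n) (suc k)) ∎
  where open ≡-Reasoning

taylor-split : ∀ m n k d → k ≤ n → (∀ j → k < j → j ≤ n → d ∣ taylor m n k j) →
               Σ ℕ λ E → sm m n k ≡ s n k + E × d ∣ E
taylor-split m n k d k≤n d∣later
  with sum<-split (suc n) k (taylor m n k) d (s≤s k≤n)
         (λ j j<k → cong (λ c → c * m ^ (j ∸ k) * s n j) (k>n⇒nCk≡0 j<k))
         (λ j k<j j<1+n → d∣later j k<j (≤-pred j<1+n))
... | E , sum≡ , d∣E = E , trans (taylor-shift m n k (suc n) ≤-refl) (trans sum≡ (cong (_+ E) leading)) , d∣E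
  where
  leading : taylor m n k k ≡ s n k
  leading rewrite nCn≡1 k | n∸n≡0 k = *-identityˡ (s n k)

s-above : ∀ {n k} → n < k → s n k ≡ 0
s-above {zero}  {suc k} _ = refl
s-above {suc n} {suc k} (s<s n<k) rewrite s-above n<k | s-above (m<n⇒m<1+n n<k) = *-zeroʳ n

s-diag : ∀ n → s n n ≡ 1
s-diag zero    = refl
s-diag (suc n) rewrite s-diag n | s-above (n<1+n n) = cong suc (*-zeroʳ n)

s-pos : ∀ {n k} → 1 ≤ k → k ≤ n → 1 ≤ s n k
s-pos {suc zero}    {suc zero}    _ _ = s≤s z≤n
s-pos {suc (suc n)} {suc zero}    _ _ =
  ≤-trans (*-mono-≤ {1} {suc n} (s≤s z≤n) (s-pos {suc n} {1} ≤-refl (s≤s z≤n))) (m≤n+m _ (s (suc n) 0))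
s-pos {suc n}       {suc (suc k)} _ (s≤s k+1≤n) = ≤-trans (s-pos {n} {suc k} (s≤s z≤n) k+1≤n) (m≤m+n _ _)

s-subdiag : ∀ a → 2 * s (suc a) a ≡ suc a * a
s-subdiag zero    = refl
s-subdiag (suc a) = begin
  2 * (s (suc a) a + suc a * s (suc a) (suc a)) ≡⟨ cong (λ z → 2 * (s (suc a) a + suc a * z)) (s-diag (suc a)) ⟩
  2 * (s (suc a) a + suc a * 1)                 ≡⟨ distribute (s (suc a) a) a ⟩
  2 * s (suc a) a + 2 * suc a                   ≡⟨ cong (_+ 2 * suc a) (s-subdiag a) ⟩
  suc a * a + 2 * suc a                         ≡⟨ collect a ⟩
  suc (suc a) * suc a                           ∎
  where
  open ≡-Reasoning
  distribute : ∀ x a → 2 * (x + suc a * 1) ≡ 2 * x + 2 * suc a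
  distribute = ℕ-solve
  collect : ∀ a → suc a * a + 2 * suc a ≡ suc (suc a) * suc a
  collect = ℕ-solve

exact-pow-odd : ∀ v {y} → ¬ 2 ∣ y → Exact v (2 ^ v * y)
exact-pow-odd zero    {y} ¬2∣y = subst (Exact 0) (sym (*-identityˡ y)) (exact-odd ¬2∣y)
exact-pow-odd (suc v) {y} ¬2∣y = subst (Exact (suc v)) (sym (*-assoc 2 (2 ^ v) y)) (exact-double (exact-pow-odd v ¬2∣y))

C-subdiag : ∀ t → suc t C t ≡ suc t
C-subdiag t = trans (nCk≡nC[n∸k] (n≤1+n t)) (trans (cong (suc t C_) (m+n∸n≡m 1 t)) (nC1≡n (suc t)))

pred-of-even : ∀ {t} → 2 ∣ suc t → ¬ 2 ∣ t
pred-of-even 2∣1+t 2∣t = case ∣1⇒≡1 (∣m+n∣m⇒∣n (subst (2 ∣_) (+-comm 1 _) 2∣1+t) 2∣t) of λ ()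

-- s(2^(v+1), 2^(v+1) - 1) = 2^v (2^(v+1) - 1) has exact valuation v.
exact-subdiag : ∀ v t → suc t ≡ 2 ^ suc v → Exact v (s (suc t) t)
exact-subdiag v t 1+t≡2^[1+v] = subst (Exact v) (sym s≡2^v*t) (exact-pow-odd v (pred-of-even 2∣1+t))
  where
  2∣1+t : 2 ∣ suc t
  2∣1+t = divides (2 ^ v) (trans 1+t≡2^[1+v] (*-comm 2 (2 ^ v)))
  s≡2^v*t : s (suc t) t ≡ 2 ^ v * t
  s≡2^v*t = *-cancelˡ-≡ _ _ 2 (begin
    2 * s (suc t) t  ≡⟨ s-subdiag t ⟩
    suc t * t        ≡⟨ cong (_* t) 1+t≡2^[1+v] ⟩
    2 * 2 ^ v * t    ≡⟨ *-assoc 2 (2 ^ v) t ⟩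
    2 * (2 ^ v * t)  ∎)
    where open ≡-Reasoning

half-even : ∀ q → 2 * q / 2 ≡ q
half-even q = trans (cong (_/ 2) (*-comm 2 q)) (m*n/n≡m q 2)

half-odd : ∀ q → (1 + 2 * q) / 2 ≡ q
half-odd q = trans (+-distrib-/-∣ʳ 1 {d = 2} (m∣m*n q)) (half-even q)

eps-even : ∀ q → eps (2 * q) ≡ 0
eps-even q = trans (cong (_% 2) (*-comm 2 q)) (m*n%n≡0 q 2)

eps-odd : ∀ q → eps (1 + 2 * q) ≡ 1
eps-odd q = trans (cong (λ z → (1 + z) % 2) (*-comm 2 q)) ([m+kn]%n≡m%n 1 q 2)

-- The right-hand side of the hypothesis as a polynomial in A = 2^n, B = 2^m, N = n, M = m, d = 2⌊k/2⌋,
-- w = v2(⌊k/2⌋) and e = ε_k.  It is inlined so that the ring solver sees the polynomial.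
Ψ : ℤ → ℤ → ℤ → ℤ → ℤ → ℤ → ℤ → ℤ
{-# INLINE Ψ #-}
Ψ A B N M d w e = ((((A ℤ.- B) ℤ.- (N ℤ.- M) ℤ.* (B ℤ.- d)) ℤ.+ M ℤ.- + 2) ℤ.- w) ℤ.+ (N ℤ.- + 1) ℤ.* e

rhs-even : ∀ n m q → rhs n m (2 * q) ≡ Ψ (+ (2 ^ n)) (+ (2 ^ m)) (+ n) (+ m) (+ (2 * q)) (+ v2ℕ q) (+ 0)
rhs-even n m q = cong₂ (λ h e → Ψ (+ (2 ^ n)) (+ (2 ^ m)) (+ n) (+ m) (+ (2 * h)) (+ v2ℕ h) (+ e)) (half-even q) (eps-even q)

rhs-odd : ∀ n m q → rhs n m (1 + 2 * q) ≡ Ψ (+ (2 ^ n)) (+ (2 ^ m)) (+ n) (+ m) (+ (2 * q)) (+ v2ℕ q) (+ 1)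
rhs-odd n m q = cong₂ (λ h e → Ψ (+ (2 ^ n)) (+ (2 ^ m)) (+ n) (+ m) (+ (2 * h)) (+ v2ℕ h) (+ e)) (half-odd q) (eps-odd q)

-- Passing from k = 2q to k = 2q+1 only switches on the term (n-1)ε_k.
rhs-parity : ∀ n m q → rhs n m (1 + 2 * q) ℤ.+ + 1 ≡ rhs n m (2 * q) ℤ.+ + n
rhs-parity n m q = begin
  rhs n m (1 + 2 * q) ℤ.+ + 1          ≡⟨ cong (ℤ._+ + 1) (rhs-odd n m q) ⟩
  Ψ A B (+ n) (+ m) d w (+ 1) ℤ.+ + 1  ≡⟨ switch-parity A B (+ n) (+ m) d w ⟩
  Ψ A B (+ n) (+ m) d w (+ 0) ℤ.+ + n  ≡⟨ cong (ℤ._+ + n) (rhs-even n m q) ⟨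
  rhs n m (2 * q) ℤ.+ + n              ∎
  where
  open ≡-Reasoning
  A = + (2 ^ n)
  B = + (2 ^ m)
  d = + (2 * q)
  w = + v2ℕ q
  switch-parity : ∀ A B N M d w → Ψ A B N M d w (+ 1) ℤ.+ + 1 ≡ Ψ A B N M d w (+ 0) ℤ.+ N
  switch-parity = ℤ-solve

-- Passing from k = 2p+1 to k = 2p+2 raises ⌊k/2⌋ by one.
rhs-half-step : ∀ n m p →
  rhs n m (2 * suc p) ℤ.+ + (v2ℕ (suc p) + m + m) ≡ rhs n m (1 + 2 * p) ℤ.+ + (n + 1 + v2ℕ p)
rhs-half-step n m p = begin
  rhs n m (2 * suc p) ℤ.+ + (w₁ + m + m)
    ≡⟨ cong (ℤ._+ + (w₁ + m + m)) (rhs-even n m (suc p)) ⟩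
  Ψ A B (+ n) (+ m) (+ (2 * suc p)) (+ w₁) (+ 0) ℤ.+ + (w₁ + m + m)
    ≡⟨ cong (λ d → Ψ A B (+ n) (+ m) (+ d) (+ w₁) (+ 0) ℤ.+ + (w₁ + m + m)) (trans (*-suc 2 p) (+-comm 2 (2 * p))) ⟩
  Ψ A B (+ n) (+ m) (+ (2 * p + 2)) (+ w₁) (+ 0) ℤ.+ + (w₁ + m + m)
    ≡⟨ half-step A B (+ n) (+ m) (+ (2 * p)) (+ w₀) (+ w₁) ⟩
  Ψ A B (+ n) (+ m) (+ (2 * p)) (+ w₀) (+ 1) ℤ.+ + (n + 1 + w₀)
    ≡⟨ cong (ℤ._+ + (n + 1 + w₀)) (rhs-odd n m p) ⟨
  rhs n m (1 + 2 * p) ℤ.+ + (n + 1 + w₀) ∎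
  where
  open ≡-Reasoning
  A = + (2 ^ n)
  B = + (2 ^ m)
  w₀ = v2ℕ p
  w₁ = v2ℕ (suc p)
  half-step : ∀ A B N M d w₀ w₁ →
    Ψ A B N M (d ℤ.+ + 2) w₁ (+ 0) ℤ.+ (w₁ ℤ.+ M ℤ.+ M) ≡ Ψ A B N M d w₀ (+ 1) ℤ.+ (N ℤ.+ + 1 ℤ.+ w₀)
  half-step = ℤ-solve

-- k = 2 at level m+1 compared with k = 2^(m+1) + 1 at level m+2.
rhs-level-step : ∀ n m → rhs n (suc m) 2 ℤ.+ + (suc m + 1) ≡ rhs n (suc (suc m)) (1 + 2 * 2 ^ m) ℤ.+ + n
rhs-level-step n m = begin
  rhs n (suc m) 2 ℤ.+ + (suc m + 1)                 -- at k = 2 the formula computes to Ψ … (+ 2) (+ 0) (+ 0)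
    ≡⟨ level-step A Y (+ n) (+ m) ⟩
  Ψ A (+ 2 ℤ.* Y) (+ n) (+ suc (suc m)) Y (+ m) (+ 1) ℤ.+ + n
    ≡⟨ cong₂ (λ B w → Ψ A B (+ n) (+ suc (suc m)) Y w (+ 1) ℤ.+ + n) (ℤP.pos-* 2 (2 ^ suc m)) (cong +_ (v2ℕ-pow m)) ⟨
  Ψ A (+ 2 ^ suc (suc m)) (+ n) (+ suc (suc m)) Y (+ v2ℕ (2 ^ m)) (+ 1) ℤ.+ + n
    ≡⟨ cong (ℤ._+ + n) (rhs-odd n (suc (suc m)) (2 ^ m)) ⟨
  rhs n (suc (suc m)) (1 + 2 * 2 ^ m) ℤ.+ + n ∎
  where
  open ≡-Reasoning
  A = + (2 ^ n)
  Y = + (2 ^ suc m)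
  level-step : ∀ A Y N M →
    Ψ A Y N (+ 1 ℤ.+ M) (+ 2) (+ 0) (+ 0) ℤ.+ (+ 1 ℤ.+ M ℤ.+ + 1)
      ≡ Ψ A (+ 2 ℤ.* Y) N (+ 1 ℤ.+ (+ 1 ℤ.+ M)) Y M (+ 1) ℤ.+ N
  level-step = ℤ-solve

rhs-top : ∀ n → rhs n n 2 ℤ.+ + 2 ≡ + n
rhs-top n = top (+ (2 ^ n)) (+ n)
  where
  top : ∀ A N → Ψ A A N N (+ 2) (+ 0) (+ 0) ℤ.+ + 2 ≡ N
  top = ℤ-solve

transfer : ∀ {a b c d x y} → + a ≡ x → + b ≡ y → x ℤ.+ + c ≡ y ℤ.+ + d → a + c ≡ b + d
transfer refl refl x+c≡y+d = ℤP.+-injective x+c≡y+d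

data Window (n t : ℕ) : Set where
  window : ∀ m k → 2 ≤ m → m ≤ n → 2 ≤ k → k ≤ 2 ^ (m ∸ 1) + 1 → t + k ≡ 2 ^ m → Window n t

window-at : ∀ {n t} m → 1 ≤ m → suc m ≤ n → 2 ^ m ≤ t + 1 → t + 2 ≤ 2 ^ suc m → Window n t
window-at {t = t} m 1≤m m<n lower upper =
  window (suc m) (2 ^ suc m ∸ t) (s≤s 1≤m) m<n 2≤k k≤ (m+[n∸m]≡n (m+n≤o⇒m≤o t upper))
  where
  2≤k : 2 ≤ 2 ^ suc m ∸ t
  2≤k = m+n≤o⇒m≤o∸n 2 (≤-trans (≤-reflexive (+-comm 2 t)) upper)
  k≤ : 2 ^ suc m ∸ t ≤ 2 ^ m + 1
  k≤ = m≤n+o⇒m∸n≤o (2 ^ suc m) t (begin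
    2 ^ m + (2 ^ m + 0) ≡⟨ cong (λ z → 2 ^ m + z) (+-identityʳ (2 ^ m)) ⟩
    2 ^ m + 2 ^ m       ≤⟨ +-monoˡ-≤ (2 ^ m) lower ⟩
    t + 1 + 2 ^ m       ≡⟨ +-assoc t 1 (2 ^ m) ⟩
    t + (1 + 2 ^ m)     ≡⟨ cong (λ z → t + z) (+-comm 1 (2 ^ m)) ⟩
    t + (2 ^ m + 1)     ∎)
    where open ≤-Reasoning

2^-≥3 : ∀ {a} → 3 ≤ 2 ^ a → 2 ≤ a
2^-≥3 {zero}        (s≤s ())
2^-≥3 {suc zero}    (s≤s (s≤s ()))
2^-≥3 {suc (suc a)} _ = s≤s (s≤s z≤n)

-- Every 1 ≤ t ≤ 2^n - 2 lies in some window (take the least m with t + 2 ≤ 2^m).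
windows : ∀ n → 2 ≤ n → ∀ {t} → 1 ≤ t → t + 2 ≤ 2 ^ n → Window n t
windows (suc n) (s≤s 1≤n) {t} 1≤t fits with t + 2 ≤? 2 ^ n
... | no ¬fits = window-at n 1≤n ≤-refl (≤-pred (≤-trans (≰⇒> ¬fits) (≤-reflexive (+-suc t 1)))) fits
... | yes fits with windows n (2^-≥3 (≤-trans (+-monoˡ-≤ 2 1≤t) fits)) 1≤t fits
...   | window m k 2≤m m≤n 2≤k k≤ t+k≡2^m = window m k 2≤m (m≤n⇒m≤1+n m≤n) 2≤k k≤ t+k≡2^m

data HalfView : ℕ → Set where
  even : ∀ q → HalfView (2 * q)
  odd  : ∀ q → HalfView (1 + 2 * q)

half-view : ∀ k → HalfView k
half-view zero = even 0
half-view (suc k) with half-view k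
... | even q = odd q
... | odd q  = subst HalfView (*-suc 2 q) (even (suc q))

even-part : ∀ {a b c} → 1 ≤ c → a + 2 * b ≡ 2 ^ c → 2 ∣ a
even-part {a} {b} {suc c} _ eq =
  ∣m+n∣m⇒∣n (subst (2 ∣_) (trans (sym eq) (+-comm a (2 * b))) (m∣m*n (2 ^ c))) (m∣m*n b)

2≤2^+1 : ∀ a → 2 ≤ 2 ^ a + 1
2≤2^+1 a = ≤-trans (s≤s (m^n>0 2 a)) (≤-reflexive (+-comm 1 (2 ^ a)))

module Valuations (n : ℕ) (2≤n : 2 ≤ n)
  (hyp : (m k : ℕ) → 2 ≤ m → m ≤ n → 2 ≤ k → k ≤ 2 ^ (m ∸ 1) + 1 →
         Σ ℕ (λ v → ν2 (+ s (2 ^ n) (2 ^ m ∸ k)) ≡ fin v × + v ≡ rhs n m k)) where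

  N : ℕ
  N = 2 ^ n

  V : ℕ → ℕ
  V t = v2ℕ (s N t)

  exact-V : ∀ {t} → 1 ≤ t → t ≤ N → Exact (V t) (s N t)
  exact-V 1≤t t≤N = v2ℕ-exact (s-pos 1≤t t≤N)

  V-formula : ∀ {t m k} → 2 ≤ m → m ≤ n → 2 ≤ k → k ≤ 2 ^ (m ∸ 1) + 1 → t + k ≡ 2 ^ m → + V t ≡ rhs n m k
  V-formula {t} {m} {k} 2≤m m≤n 2≤k k≤ t+k≡2^m with hyp m k 2≤m m≤n 2≤k k≤
  ... | v , ν2≡v , v≡rhs = trans (cong +_ (ν2-fin (subst (λ u → ν2 (+ s N u) ≡ fin v) 2^m∸k≡t ν2≡v))) v≡rhs
    where
    2^m∸k≡t : 2 ^ m ∸ k ≡ t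
    2^m∸k≡t = trans (cong (_∸ k) (sym t+k≡2^m)) (m+n∸n≡m t k)

  Step : ℕ → Set
  Step t = (V t + 1 ≤ V (suc t) + n) × (2 ∣ suc t ⊎ V t + 2 ≤ V (suc t) + n)

  strong-step : ∀ {t} → V t + 2 ≤ V (suc t) + n → Step t
  strong-step {t} strong = ≤-trans (+-monoʳ-≤ (V t) (n≤1+n 1)) strong , inj₂ strong

  even-step : ∀ {t} → 2 ∣ suc t → V t + 1 ≤ V (suc t) + n → Step t
  even-step 2∣1+t weak = weak , inj₁ 2∣1+t

  -- k = 2q + 3: the formula at t and at t + 1 (with k - 1 = 2q + 2) differ exactly by n - 1, and t + 1 is even.
  step-odd : ∀ {t m} q → 2 ≤ m → m ≤ n → 1 + 2 * suc q ≤ 2 ^ (m ∸ 1) + 1 → t + (1 + 2 * suc q) ≡ 2 ^ m → Step t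
  step-odd {t} {m} q 2≤m m≤n k≤ t+k≡2^m =
    even-step (even-part {b = suc q} (≤-trans (n≤1+n 1) 2≤m) t+1+k≡2^m)
              (≤-reflexive (transfer V-t V-t+1 (rhs-parity n m (suc q))))
    where
    t+1+k≡2^m : suc t + 2 * suc q ≡ 2 ^ m
    t+1+k≡2^m = trans (sym (+-suc t (2 * suc q))) t+k≡2^m
    V-t = V-formula 2≤m m≤n (s≤s (s≤s z≤n)) k≤ t+k≡2^m
    V-t+1 = V-formula 2≤m m≤n (*-monoʳ-≤ 2 (s≤s z≤n)) (≤-trans (n≤1+n _) k≤) t+1+k≡2^m

  -- k = 2 at the top level m = n: the formula gives V t = n - 2.
  step-top : ∀ {t} → t + 2 ≡ N → Step t
  step-top {t} t+2≡N = strong-step (≤-trans (≤-reflexive V+2≡n) (m≤n+m n (V (suc t))))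
    where
    V+2≡n : V t + 2 ≡ n
    V+2≡n = ℤP.+-injective (trans (cong (ℤ._+ + 2) (V-formula 2≤n ≤-refl ≤-refl (2≤2^+1 (n ∸ 1)) t+2≡N)) (rhs-top n))

  -- k = 2 at a level m + 1 < n: t + 1 = 2^(m+2) - (2^(m+1) + 1) lies in the window of level m + 2.
  step-level : ∀ {t} m → 1 ≤ m → suc (suc m) ≤ n → t + 2 ≡ 2 ^ suc m → Step t
  step-level {t} m 1≤m m+2≤n t+2≡2^[1+m] = strong-step (begin
    V t + 2           ≤⟨ +-monoʳ-≤ (V t) (≤-trans (s≤s 1≤m) (m≤m+n (suc m) 1)) ⟩
    V t + (suc m + 1) ≡⟨ transfer V-t V-t+1 (rhs-level-step n m) ⟩
    V (suc t) + n     ∎)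
    where
    open ≤-Reasoning
    t+1+k≡2^[2+m] : suc t + (1 + 2 * 2 ^ m) ≡ 2 ^ suc (suc m)
    t+1+k≡2^[2+m] = trans (regroup t (2 ^ suc m)) (trans (cong (_+ 2 ^ suc m) t+2≡2^[1+m]) (double (2 ^ suc m)))
      where
      regroup : ∀ t x → suc t + (1 + x) ≡ t + 2 + x
      regroup = ℕ-solve
      double : ∀ x → x + x ≡ 2 * x
      double = ℕ-solve
    V-t = V-formula (s≤s 1≤m) (<⇒≤ m+2≤n) ≤-refl (2≤2^+1 m) t+2≡2^[1+m]
    V-t+1 = V-formula (s≤s (s≤s z≤n)) m+2≤n (≤-trans (*-monoʳ-≤ 2 (m^n>0 2 m)) (n≤1+n _))
                      (≤-reflexive (+-comm 1 (2 ^ suc m))) t+1+k≡2^[2+m]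

  -- k = 2P + 2 with P = p + 1 at level m = c + 2: by the formula at k and k - 1 = 2P + 1,
  -- V (t+1) - V t = v2(P+1) - v2(P) + 2m - n - 1, and v2(P) < c because P < 2^c; so V drops by at most n - 2.
  step-even : ∀ {t} c p → suc (suc c) ≤ n → 2 * suc (suc p) ≤ 2 ^ suc c + 1 →
              t + 2 * suc (suc p) ≡ 2 ^ suc (suc c) → Step t
  step-even {t} c p m≤n k≤ t+k≡2^m = strong-step (+-cancelʳ-≤ c (V t + 2) (V (suc t) + n) (begin
    V t + 2 + c            ≡⟨ +-assoc (V t) 2 c ⟩
    V t + m                ≤⟨ +-monoʳ-≤ (V t) (m≤n+m m (w₁ + m)) ⟩
    V t + (w₁ + m + m)     ≡⟨ transfer V-t V-t+1 (rhs-half-step n m P) ⟩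
    V (suc t) + (n + 1 + w₀) ≡⟨ cong (λ z → V (suc t) + z) (+-assoc n 1 w₀) ⟩
    V (suc t) + (n + suc w₀) ≤⟨ +-monoʳ-≤ (V (suc t)) (+-monoʳ-≤ n w₀<c) ⟩
    V (suc t) + (n + c)    ≡⟨ +-assoc (V (suc t)) n c ⟨
    V (suc t) + n + c      ∎))
    where
    open ≤-Reasoning
    P = suc p
    m = suc (suc c)
    w₀ = v2ℕ P
    w₁ = v2ℕ (suc P)
    t+1+k≡2^m : suc t + (1 + 2 * P) ≡ 2 ^ m
    t+1+k≡2^m = trans (regroup t P) t+k≡2^m
      where
      regroup : ∀ t p → suc t + (1 + 2 * p) ≡ t + 2 * suc p
      regroup = ℕ-solve
    2P<2·2^c : 2 * P < 2 * 2 ^ c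
    2P<2·2^c = ≤-pred (≤-trans (≤-reflexive (sym (*-suc 2 P))) (≤-trans k≤ (≤-reflexive (+-comm (2 ^ suc c) 1))))
    w₀<c : w₀ < c
    w₀<c = exact-< (v2ℕ-exact (s≤s z≤n)) (s≤s z≤n) (*-cancelˡ-< 2 P (2 ^ c) 2P<2·2^c)
    V-t = V-formula (s≤s (s≤s z≤n)) m≤n (s≤s (s≤s z≤n)) k≤ t+k≡2^m
    V-t+1 = V-formula (s≤s (s≤s z≤n)) m≤n (s≤s (s≤s z≤n))
                      (≤-trans (≤-trans (n≤1+n _) (≤-reflexive (sym (*-suc 2 P)))) k≤) t+1+k≡2^m

  -- t = 2^n - 1: s(2^n, 2^n - 1) has valuation n - 1 while s(2^n, 2^n) = 1.
  step-last : ∀ {t} → suc t ≡ N → Step t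
  step-last {t} 1+t≡N = even-step 2∣1+t (begin
    V t + 1         ≡⟨ cong (_+ 1) V-t≡n-1 ⟩
    n ∸ 1 + 1       ≡⟨ m∸n+n≡m (≤-trans (n≤1+n 1) 2≤n) ⟩
    n               ≡⟨ cong (_+ n) V-t+1≡0 ⟨
    V (suc t) + n   ∎)
    where
    open ≤-Reasoning
    n≡1+[n-1] : n ≡ suc (n ∸ 1)
    n≡1+[n-1] = sym (m+[n∸m]≡n (≤-trans (n≤1+n 1) 2≤n))
    2∣1+t : 2 ∣ suc t
    2∣1+t = divides (2 ^ (n ∸ 1)) (trans 1+t≡N (trans (cong (2 ^_) n≡1+[n-1]) (*-comm 2 (2 ^ (n ∸ 1)))))
    V-t≡n-1 : V t ≡ n ∸ 1
    V-t≡n-1 = v2ℕ-of-exact (subst (λ x → Exact (n ∸ 1) (s x t)) 1+t≡N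
                (exact-subdiag (n ∸ 1) t (trans 1+t≡N (cong (2 ^_) n≡1+[n-1]))))
    V-t+1≡0 : V (suc t) ≡ 0
    V-t+1≡0 = cong v2ℕ (trans (cong (s N) 1+t≡N) (s-diag N))

  window-step : ∀ {t} → Window n t → Step t
  window-step (window zero          _ () _ _ _ _)
  window-step (window (suc zero)    _ (s≤s ()) _ _ _ _)
  window-step {t} (window (suc (suc c)) k _ m≤n 2≤k k≤ t+k≡2^m) with half-view k
  ... | odd zero             = ⊥-elim (n≮n 1 2≤k)
  ... | odd (suc q)          = step-odd q (s≤s (s≤s z≤n)) m≤n k≤ t+k≡2^m
  ... | even zero            = ⊥-elim (<⇒≱ 2≤k z≤n)
  ... | even (suc (suc p))   = step-even c p m≤n k≤ t+k≡2^m
  ... | even (suc zero) with suc (suc c) ≟ n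
  ...   | yes m≡n = step-top (subst (λ x → t + 2 ≡ 2 ^ x) m≡n t+k≡2^m)
  ...   | no  m≢n = step-level (suc c) (s≤s z≤n) (≤∧≢⇒< m≤n m≢n) t+k≡2^m

  local-step : ∀ {t} → 1 ≤ t → t < N → Step t
  local-step {t} 1≤t t<N with t + 2 ≤? N
  ... | yes fits = window-step (windows n 2≤n 1≤t fits)
  ... | no ¬fits = step-last (≤-antisym t<N (≤-pred (≤-trans (≰⇒> ¬fits) (≤-reflexive (+-comm t 2)))))

  drift : ∀ d {t} → 1 ≤ t → d + t ≤ N → V t + d ≤ V (d + t) + n * d
  drift zero    {t} _ _ = +-monoʳ-≤ (V t) z≤n
  drift (suc d) {t} 1≤t fits = begin
    V t + suc d                   ≡⟨ +-suc (V t) d ⟩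
    suc (V t + d)                 ≤⟨ s≤s (drift d 1≤t (<⇒≤ fits)) ⟩
    suc (V (d + t) + n * d)       ≡⟨ move-suc (V (d + t)) (n * d) ⟩
    n * d + (V (d + t) + 1)       ≤⟨ +-monoʳ-≤ (n * d) (proj₁ (local-step (≤-trans 1≤t (m≤n+m t d)) fits)) ⟩
    n * d + (V (suc d + t) + n)   ≡⟨ regroup (n * d) (V (suc d + t)) n ⟩
    V (suc d + t) + (n + n * d)   ≡⟨ cong (λ z → V (suc d + t) + z) (*-suc n d) ⟨
    V (suc d + t) + n * suc d     ∎
    where
    open ≤-Reasoning
    move-suc : ∀ a b → suc (a + b) ≡ b + (a + 1)
    move-suc = ℕ-solve
    regroup : ∀ a b c → a + (b + c) ≡ b + (c + a)
    regroup = ℕ-solve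

  power-div : ∀ d {j} → 1 ≤ j → j ≤ N → 2 ^ (V j + n * d) ∣ N ^ d * s N j
  power-div d {j} 1≤j j≤N = subst (_∣ N ^ d * s N j) N^d*2^V≡2^[V+nd] (*-monoʳ-∣ (N ^ d) (pow∣ (exact-V 1≤j j≤N)))
    where
    N^d*2^V≡2^[V+nd] : N ^ d * 2 ^ V j ≡ 2 ^ (V j + n * d)
    N^d*2^V≡2^[V+nd] = begin
      N ^ d * 2 ^ V j         ≡⟨ cong (_* 2 ^ V j) (^-*-assoc 2 n d) ⟩
      2 ^ (n * d) * 2 ^ V j   ≡⟨ *-comm (2 ^ (n * d)) (2 ^ V j) ⟩
      2 ^ V j * 2 ^ (n * d)   ≡⟨ ^-distribˡ-+-* 2 (V j) (n * d) ⟨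
      2 ^ (V j + n * d)       ∎
      where open ≡-Reasoning

  taylor-at : ∀ d t → taylor N N t (d + t) ≡ ((d + t) C t) * (N ^ d * s N (d + t))
  taylor-at d t = trans (cong (λ e → ((d + t) C t) * N ^ e * s N (d + t)) (m+n∸n≡m d t))
                        (*-assoc ((d + t) C t) (N ^ d) (s N (d + t)))

  -- Every summand j > t in the expansion of s_N(N,t) is divisible by 2^(V t + 2): for j ≥ t + 2 by the drift bound,
  -- for j = t + 1 by the local step together with the factor C(t+1,t) = t + 1.
  term-div : ∀ {t} → 1 ≤ t → ∀ j → t < j → j ≤ N → 2 ^ (V t + 2) ∣ taylor N N t j
  term-div {t} 1≤t j t<j j≤N =
    subst (λ i → 2 ^ (V t + 2) ∣ taylor N N t i) (m∸n+n≡m (<⇒≤ t<j))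
          (at-distance (j ∸ t) (m<n⇒0<n∸m t<j) (subst (_≤ N) (sym (m∸n+n≡m (<⇒≤ t<j))) j≤N))
    where
    at-distance : ∀ d → 1 ≤ d → d + t ≤ N → 2 ^ (V t + 2) ∣ taylor N N t (d + t)
    at-distance (suc (suc d)) _ fits = subst (2 ^ (V t + 2) ∣_) (sym (taylor-at (suc (suc d)) t))
      (∣-trans (2^-mono-∣ (≤-trans (+-monoʳ-≤ (V t) (s≤s (s≤s z≤n))) (drift (suc (suc d)) 1≤t fits)))
               (∣n⇒∣m*n ((suc (suc d) + t) C t) (power-div (suc (suc d)) (≤-trans 1≤t (m≤n+m t (suc (suc d)))) fits)))
    at-distance (suc zero) _ fits =
      subst (2 ^ (V t + 2) ∣_) (sym (trans (taylor-at 1 t) (cong (_* (N ^ 1 * s N (suc t))) (C-subdiag t))))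
            (next-term (local-step 1≤t fits))
      where
      next-div : 2 ^ (V (suc t) + n * 1) ∣ N ^ 1 * s N (suc t)
      next-div = power-div 1 (s≤s z≤n) fits
      n*1≡n : V (suc t) + n * 1 ≡ V (suc t) + n
      n*1≡n = cong (λ z → V (suc t) + z) (*-identityʳ n)
      next-term : Step t → 2 ^ (V t + 2) ∣ suc t * (N ^ 1 * s N (suc t))
      next-term (weak , inj₁ 2∣1+t) = subst (_∣ suc t * (N ^ 1 * s N (suc t))) (cong (2 ^_) (sym (+-suc (V t) 1)))
        (*-pres-∣ 2∣1+t (∣-trans (2^-mono-∣ (≤-trans weak (≤-reflexive (sym n*1≡n)))) next-div))
      next-term (_ , inj₂ strong) =
        ∣n⇒∣m*n (suc t) (∣-trans (2^-mono-∣ (≤-trans strong (≤-reflexive (sym n*1≡n)))) next-div)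

lemma2p4 : (n : ℕ) → 2 ≤ n →
    ((m k : ℕ) → 2 ≤ m → m ≤ n → 2 ≤ k → k ≤ 2 ^ (m ∸ 1) + 1 →
      Σ ℕ (λ v → ν2 (+ s (2 ^ n) (2 ^ m ∸ k)) ≡ fin v × + v ≡ rhs n m k)) →
    (t : ℕ) → 1 ≤ t → t ≤ 2 ^ n →
      (ν2 (+ sm (2 ^ n) (2 ^ n) t) ≡ ν2 (+ s (2 ^ n) t))
      × (ν2 (+ s (2 ^ n) t) +∞ 2 ≤∞ ν2 (+ sm (2 ^ n) (2 ^ n) t ℤ.- + s (2 ^ n) t))
lemma2p4 n 2≤n hyp t 1≤t t≤N =
  let open Valuations n 2≤n hyp
      (E , sm≡s+E , 2^[V+2]∣E) = taylor-split N N t (2 ^ (V t + 2)) t≤N (term-div 1≤t)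
  in subst (λ x → (ν2 (+ x) ≡ ν2 (+ s N t)) × (ν2 (+ s N t) +∞ 2 ≤∞ ν2 (+ x ℤ.- + s N t)))
           (sym sm≡s+E) (perturbation (exact-V 1≤t t≤N) 2^[V+2]∣E)
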